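{- Let $m$ and $n$ be positive integers. Then both the longest snake path and the longest snake cycle in the grid graph of size $m \times n$ are of length $2mn/3 + \mathcal{O}(m + n)$.
   Context: The grid graph of size $m\times n$ has vertex set $[0;n-1]\times[0;m-1]\subset\mathbb{Z}^2$, two cells adjacent iff at Euclidean distance $1$. A snake path (cycle) is a path (cycle) which is an induced subgraph; length is the number of edges. The $\mathcal{O}$-term bounds the absolute value of the difference with an absolute implied constant. -}

module Defs where

open import Data.Nat using (ℕ; zero; suc; _+_; _*_; _<_; _≤_)
open import Data.Fin using (Fin; toℕ)
open import Data.Product using (Σ; _×_; _,_; proj₁; proj₂)
open import Data.Sum using (_⊎_)
open import Relation.Binary.PropositionalEquality using (_≡_)
open import Function.Bundles using (_⇔_)

Cell : Set
Cell = ℕ × ℕ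

InGrid : ℕ → ℕ → Cell → Set
InGrid m n (x , y) = (x < n) × (y < m)

Adj : Cell → Cell → Set
Adj (x₁ , y₁) (x₂ , y₂) =
  ((x₁ ≡ x₂) × ((suc y₁ ≡ y₂) ⊎ (suc y₂ ≡ y₁)))
  ⊎ ((y₁ ≡ y₂) × ((suc x₁ ≡ x₂) ⊎ (suc x₂ ≡ x₁)))

PathNbr : {k : ℕ} → Fin k → Fin k → Set
PathNbr i j = (suc (toℕ i) ≡ toℕ j) ⊎ (suc (toℕ j) ≡ toℕ i)

CycNbr : (k : ℕ) → Fin k → Fin k → Set
CycNbr k i j =
  PathNbr i j
  ⊎ ((suc (toℕ i) ≡ k) × (toℕ j ≡ 0))
  ⊎ ((suc (toℕ j) ≡ k) × (toℕ i ≡ 0))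

-- A snake path of length k (k edges, k+1 distinct vertices v₀ … v_k)
-- in the m × n grid: an induced path, i.e. two of its vertices are
-- adjacent in the grid iff they are consecutive on the path.
record SnakePath (m n k : ℕ) : Set where
  field
    vertex   : Fin (suc k) → Cell
    inGrid   : ∀ i → InGrid m n (vertex i)
    distinct : ∀ i j → vertex i ≡ vertex j → i ≡ j
    induced  : ∀ i j → Adj (vertex i) (vertex j) ⇔ PathNbr i j

-- A snake cycle of length k (k ≥ 3 edges, k distinct vertices v₀ … v_{k-1})
-- in the m × n grid: an induced cycle, i.e. two of its vertices are
-- adjacent in the grid iff they are cyclically consecutive.
record SnakeCycle (m n k : ℕ) : Set where
  field
    long     : 3 ≤ k
    vertex   : Fin k → Cell
    inGrid   : ∀ i → InGrid m n (vertex i)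
    distinct : ∀ i j → vertex i ≡ vertex j → i ≡ j
    induced  : ∀ i j → Adj (vertex i) (vertex j) ⇔ CycNbr k i j

module Submission where

open import Defs
open import Data.Nat using (ℕ; zero; suc; _+_; _*_; _≤_; _<_; z≤n; s≤s; s≤s⁻¹; _∸_; _≟_; _<?_; _/_; _%_)
open import Data.Nat.Properties
open import Data.Nat.DivMod using (m≡m%n+[m/n]*n; m%n<n)
open import Data.Nat.Tactic.RingSolver using (solve-∀)
open import Data.Fin using (Fin; toℕ; fromℕ; fromℕ<; combine; remQuot)
open import Data.Fin.Patterns using (0F; 1F; 2F)
import Data.Fin.Properties as Finₚ
open import Data.Bool using (Bool; true; false)
open import Data.Product using (Σ; ∃-syntax; _×_; _,_; proj₁; proj₂; uncurry)
open import Data.Product.Properties using (≡-dec)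
open import Data.Sum using (_⊎_; inj₁; inj₂)
import Data.Sum as Sum
open import Data.List using (List; []; _∷_; length; lookup)
open import Data.List.Relation.Unary.All as All using (All; []; _∷_)
open import Data.List.Membership.Propositional.Properties using (∈-lookup)
open import Data.Empty using (⊥; ⊥-elim)
open import Relation.Nullary using (¬_; Dec; yes; no)
open import Relation.Binary.PropositionalEquality
open import Function.Base using (_∘_; _∘′_)
open import Function.Bundles using (Equivalence; mk⇔)

-- Upper bound: give every vertex v of a snake three tokens (cell, colour),
-- namely (v, 0), (v, 1) and a token on a free neighbour of v: its right
-- neighbour if free, else its upper one, else its left one, which is then free
-- because v has at most two neighbours on the snake. The tokens are pairwise
-- distinct and lie in a box of 2(m + 1)(n + 2) tokens, so 3N ≤ 2mn + O(m + n).
--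
-- Lower bound: the cells of a grid region on two consecutive diagonals
-- x + y ∈ {s + 1, s + 2} form an induced staircase, and staircases on the
-- diagonals {s + 1, s + 2} and {s + 4, s + 5} never touch. Sweeping the grid by
-- such staircases, joined by short turns at its border, gives a snake through
-- two thirds of the cells up to O(m + n); a return along the top row and the
-- left column closes it into a cycle.

right up : Cell → Cell
right c = (suc (proj₁ c) , proj₂ c)
up    c = (proj₁ c , suc (proj₂ c))

adj-right : ∀ c → Adj c (right c)
adj-right c = inj₂ (refl , inj₁ refl)

adj-up : ∀ c → Adj c (up c)
adj-up c = inj₁ (refl , inj₁ refl)

right-injective : ∀ {c d} → right c ≡ right d → c ≡ d
right-injective refl = refl

adj-sym : ∀ {c d} → Adj c d → Adj d c
adj-sym (inj₁ (e , inj₁ p)) = inj₁ (sym e , inj₂ p)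
adj-sym (inj₁ (e , inj₂ p)) = inj₁ (sym e , inj₁ p)
adj-sym (inj₂ (e , inj₁ p)) = inj₂ (sym e , inj₂ p)
adj-sym (inj₂ (e , inj₂ p)) = inj₂ (sym e , inj₁ p)

adj-irrefl : ∀ {c} → ¬ Adj c c
adj-irrefl (inj₁ (_ , inj₁ p)) = 1+n≢n p
adj-irrefl (inj₁ (_ , inj₂ p)) = 1+n≢n p
adj-irrefl (inj₂ (_ , inj₁ p)) = 1+n≢n p
adj-irrefl (inj₂ (_ , inj₂ p)) = 1+n≢n p

transpose : Cell → Cell
transpose (x , y) = (y , x)

adj-transpose : ∀ {c d} → Adj c d → Adj (transpose c) (transpose d)
adj-transpose (inj₁ q) = inj₂ q
adj-transpose (inj₂ q) = inj₁ q

-- Upper bound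

AtMostTwo : {A : Set} → (A → A → Set) → Set
AtMostTwo R = ∀ {i a b c} → R i a → R i b → R i c → a ≡ b ⊎ a ≡ c ⊎ b ≡ c

bool-pigeonhole : (x y z : Bool) → x ≡ y ⊎ x ≡ z ⊎ y ≡ z
bool-pigeonhole false false _     = inj₁ refl
bool-pigeonhole true  true  _     = inj₁ refl
bool-pigeonhole false true  false = inj₂ (inj₁ refl)
bool-pigeonhole false true  true  = inj₂ (inj₂ refl)
bool-pigeonhole true  false false = inj₂ (inj₂ refl)
bool-pigeonhole true  false true  = inj₂ (inj₁ refl)

atMostTwo-byDirection : {A : Set} {R : A → A → Set} (forward : ∀ {i j} → R i j → Bool) →
  (∀ {i a b} (p : R i a) (q : R i b) → forward p ≡ forward q → a ≡ b) → AtMostTwo R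
atMostTwo-byDirection forward unique p q r
  with bool-pigeonhole (forward p) (forward q) (forward r)
... | inj₁ e        = inj₁ (unique p q e)
... | inj₂ (inj₁ e) = inj₂ (inj₁ (unique p r e))
... | inj₂ (inj₂ e) = inj₂ (inj₂ (unique q r e))

pathNbr-forward : ∀ {k} {i j : Fin k} → PathNbr i j → Bool
pathNbr-forward (inj₁ _) = true
pathNbr-forward (inj₂ _) = false

pathNbr-atMostTwo : ∀ {k} → AtMostTwo (PathNbr {k})
pathNbr-atMostTwo {k} = atMostTwo-byDirection {R = PathNbr} pathNbr-forward unique
  where
  unique : ∀ {i a b : Fin k} (p : PathNbr i a) (q : PathNbr i b) →
           pathNbr-forward p ≡ pathNbr-forward q → a ≡ b
  unique (inj₁ p) (inj₁ q) _ = Finₚ.toℕ-injective (trans (sym p) q)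
  unique (inj₂ p) (inj₂ q) _ = Finₚ.toℕ-injective (suc-injective (trans p (sym q)))

cycNbr-forward : ∀ {k} {i j : Fin k} → CycNbr k i j → Bool
cycNbr-forward (inj₁ p)        = pathNbr-forward p
cycNbr-forward (inj₂ (inj₁ _)) = true
cycNbr-forward (inj₂ (inj₂ _)) = false

cycNbr-atMostTwo : ∀ {k} → AtMostTwo (CycNbr k)
cycNbr-atMostTwo {k} = atMostTwo-byDirection {R = CycNbr k} cycNbr-forward unique
  where
  wrap-absurd : ∀ {i a : Fin k} → suc (toℕ i) ≡ toℕ a → suc (toℕ i) ≡ k → ⊥
  wrap-absurd {a = a} p w = <-irrefl (trans (sym p) w) (Finₚ.toℕ<n a)

  unique : ∀ {i a b : Fin k} (p : CycNbr k i a) (q : CycNbr k i b) →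
           cycNbr-forward p ≡ cycNbr-forward q → a ≡ b
  unique (inj₁ (inj₁ p)) (inj₁ (inj₁ q)) _ = Finₚ.toℕ-injective (trans (sym p) q)
  unique (inj₁ (inj₂ p)) (inj₁ (inj₂ q)) _ = Finₚ.toℕ-injective (suc-injective (trans p (sym q)))
  unique (inj₁ (inj₁ p)) (inj₂ (inj₁ (w , _))) _ = ⊥-elim (wrap-absurd p w)
  unique (inj₂ (inj₁ (w , _))) (inj₁ (inj₁ q)) _ = ⊥-elim (wrap-absurd q w)
  unique (inj₂ (inj₁ (_ , z))) (inj₂ (inj₁ (_ , z′))) _ = Finₚ.toℕ-injective (trans z (sym z′))
  unique (inj₁ (inj₂ p)) (inj₂ (inj₂ (_ , z))) _ with () ← trans p z
  unique (inj₂ (inj₂ (_ , z))) (inj₁ (inj₂ q)) _ with () ← trans q z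
  unique (inj₂ (inj₂ (w , _))) (inj₂ (inj₂ (w′ , _))) _ =
    Finₚ.toℕ-injective (suc-injective (trans w (sym w′)))

Token : Set
Token = Cell × Fin 2

tokens-in-box : ∀ {N} p q (f : Fin N → Token) → (∀ i → InGrid q p (proj₁ (f i))) →
                (∀ i j → f i ≡ f j → i ≡ j) → N ≤ q * p * 2
tokens-in-box p q f bounded f-injective = Finₚ.injective⇒≤ code-injective
  where
  code : Fin _ → Fin (q * p * 2)
  code i = combine (combine (fromℕ< (proj₂ (bounded i))) (fromℕ< (proj₁ (bounded i)))) (proj₂ (f i))

  code-injective : ∀ {i j} → code i ≡ code j → i ≡ j
  code-injective {i} {j} e
    with Finₚ.combine-injective _ _ _ _ e
  ... | e₁ , colour with Finₚ.combine-injective _ _ _ _ e₁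
  ... | y , x = f-injective i j (cong₂ _,_
        (cong₂ _,_ (Finₚ.fromℕ<-injective _ _ (proj₁ (bounded i)) (proj₁ (bounded j)) x)
                   (Finₚ.fromℕ<-injective _ _ (proj₂ (bounded i)) (proj₂ (bounded j)) y))
        colour)

module TokenCount {m n N : ℕ} (v : Fin N → Cell)
  (v-inGrid : ∀ i → InGrid m n (v i))
  (v-injective : ∀ i j → v i ≡ v j → i ≡ j)
  (degree≤2 : AtMostTwo (λ i j → Adj (v i) (v j))) where

  Occupied : Cell → Set
  Occupied c = ∃[ j ] v j ≡ c

  occupied? : ∀ c → Dec (Occupied c)
  occupied? c = Finₚ.any? (λ j → ≡-dec _≟_ _≟_ (v j) c)

  no-three-neighbours : ∀ {z a b c} → Occupied z → Occupied a → Occupied b → Occupied c →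
    Adj z a → Adj z b → Adj z c → a ≢ b → a ≢ c → b ≢ c → ⊥
  no-three-neighbours (_ , refl) (a , refl) (b , refl) (c , refl) za zb zc a≢b a≢c b≢c
    with degree≤2 za zb zc
  ... | inj₁ e        = a≢b (cong v e)
  ... | inj₂ (inj₁ e) = a≢c (cong v e)
  ... | inj₂ (inj₂ e) = b≢c (cong v e)

  data Exit (c : Cell) : Set where
    right-free : ¬ Occupied (right c) → Exit c
    up-free    : Occupied (right c) → ¬ Occupied (up c) → Exit c
    left-free  : Occupied (right c) → Occupied (up c) → Exit c

  exit : ∀ c → Exit c
  exit c with occupied? (right c) | occupied? (up c)
  ... | no r  | _     = right-free r
  ... | yes r | no u  = up-free r u
  ... | yes r | yes u = left-free r u

  -- Tokens sit on cells shifted one column to the right, so that the token of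
  -- the left neighbour of c is placed on c itself, even in column 0.
  exitToken : ∀ {c} → Exit c → Token
  exitToken {c} (right-free _)  = (right (right c) , 0F)
  exitToken {c} (up-free _ _)   = (right (up c) , 1F)
  exitToken {c} (left-free _ _) = (c , 1F)

  exitToken-free : ∀ {c} → Occupied c → (e : Exit c) → ∀ {d colour} →
                   exitToken e ≡ (right d , colour) → ¬ Occupied d
  exitToken-free _ (right-free r)   refl = r
  exitToken-free _ (up-free _ u)    refl = u
  exitToken-free {_ , _} z (left-free r u) refl l =
    no-three-neighbours z r u l (adj-right _) (adj-up _) (inj₂ (refl , inj₂ refl))
      (λ e → 1+n≢n (sym (cong proj₂ e))) (λ e → m≢1+n+m _ {1} (sym (cong proj₁ e)))
      (λ e → 1+n≢n (cong proj₁ e))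

  -- The one token collision that needs an argument: if the up-token of c lands
  -- on the left-token of d, then d = c + (1,1) has three neighbours on the snake.
  diagonal-collision : ∀ {x y} → Occupied (suc x , y) → Occupied (suc x , suc y) →
    Occupied (suc (suc x) , suc y) → Occupied (suc x , suc (suc y)) → ⊥
  diagonal-collision below z r u =
    no-three-neighbours z below r u (inj₁ (refl , inj₂ refl)) (adj-right _) (adj-up _)
      (λ e → m≢1+n+m _ {0} (cong proj₁ e)) (λ e → m≢1+n+m _ {1} (cong proj₂ e))
      (λ e → 1+n≢n (cong proj₁ e))

  exitToken-injective : ∀ {c d} → Occupied c → Occupied d → (e : Exit c) (e′ : Exit d) →
                        exitToken e ≡ exitToken e′ → c ≡ d
  exitToken-injective {_ , _} {_ , _} _ _ (right-free _) (right-free _) refl = refl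
  exitToken-injective {_ , _} {_ , _} _ _ (up-free _ _) (up-free _ _) refl = refl
  exitToken-injective _ _ (left-free _ _) (left-free _ _) refl = refl
  exitToken-injective {_ , _} _ z (up-free r _) (left-free r′ u′) refl = ⊥-elim (diagonal-collision r z r′ u′)
  exitToken-injective {_ , _} z _ (left-free r′ u′) (up-free r _) refl = ⊥-elim (diagonal-collision r z r′ u′)

  token : Fin 3 × Fin N → Token
  token (0F , i) = (right (v i) , 0F)
  token (1F , i) = (right (v i) , 1F)
  token (2F , i) = exitToken (exit (v i))

  token-injective : ∀ p q → token p ≡ token q → p ≡ q
  token-injective (0F , i) (0F , j) e = cong (0F ,_) (v-injective i j (right-injective (cong proj₁ e)))
  token-injective (1F , i) (1F , j) e = cong (1F ,_) (v-injective i j (right-injective (cong proj₁ e)))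
  token-injective (2F , i) (2F , j) e =
    cong (2F ,_) (v-injective i j (exitToken-injective (i , refl) (j , refl) _ _ e))
  token-injective (0F , i) (2F , j) e = ⊥-elim (exitToken-free (j , refl) _ (sym e) (i , refl))
  token-injective (1F , i) (2F , j) e = ⊥-elim (exitToken-free (j , refl) _ (sym e) (i , refl))
  token-injective (2F , i) (0F , j) e = ⊥-elim (exitToken-free (i , refl) _ e (j , refl))
  token-injective (2F , i) (1F , j) e = ⊥-elim (exitToken-free (i , refl) _ e (j , refl))

  token-inBox : ∀ p → InGrid (suc m) (suc (suc n)) (proj₁ (token p))
  token-inBox (0F , i) = s≤s (m<n⇒m<1+n (proj₁ (v-inGrid i))) , m<n⇒m<1+n (proj₂ (v-inGrid i))
  token-inBox (1F , i) = s≤s (m<n⇒m<1+n (proj₁ (v-inGrid i))) , m<n⇒m<1+n (proj₂ (v-inGrid i))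
  token-inBox (2F , i) = exitToken-inBox (exit (v i))
    where
    x< : proj₁ (v i) < n
    x< = proj₁ (v-inGrid i)
    y< : proj₂ (v i) < m
    y< = proj₂ (v-inGrid i)
    exitToken-inBox : (e : Exit (v i)) → InGrid (suc m) (suc (suc n)) (proj₁ (exitToken e))
    exitToken-inBox (right-free _)  = s≤s (s≤s x<) , m<n⇒m<1+n y<
    exitToken-inBox (up-free _ _)   = s≤s (m<n⇒m<1+n x<) , s≤s y<
    exitToken-inBox (left-free _ _) = m<n⇒m<1+n (m<n⇒m<1+n x<) , m<n⇒m<1+n y<

  three-tokens-each : 3 * N ≤ suc m * suc (suc n) * 2
  three-tokens-each = tokens-in-box (suc (suc n)) (suc m) (token ∘ remQuot N)
    (token-inBox ∘ remQuot N) (λ k l e → remQuot-injective (token-injective _ _ e))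
    where
    remQuot-injective : ∀ {k l} → remQuot {3} N k ≡ remQuot N l → k ≡ l
    remQuot-injective {k} {l} e = begin
      k                             ≡⟨ Finₚ.combine-remQuot N k ⟨
      uncurry combine (remQuot N k) ≡⟨ cong (uncurry combine) e ⟩
      uncurry combine (remQuot N l) ≡⟨ Finₚ.combine-remQuot N l ⟩
      l                             ∎
      where open ≡-Reasoning

token-box≤ : ∀ m n → 1 ≤ n → suc m * suc (suc n) * 2 ≤ 2 * (m * n) + 6 * (m + n)
token-box≤ m (suc n) _ = subst (suc m * suc (suc (suc n)) * 2 ≤_) (identity m n) (m≤m+n _ (2 * m + 4 * n))
  where
  identity : ∀ m n → suc m * suc (suc (suc n)) * 2 + (2 * m + 4 * n) ≡ 2 * (m * suc n) + 6 * (m + suc n)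
  identity = solve-∀

induced-atMostTwo : ∀ {k} {R : Fin k → Fin k → Set} (v : Fin k → Cell) → AtMostTwo R →
  (∀ i j → Adj (v i) (v j) → R i j) → AtMostTwo (λ i j → Adj (v i) (v j))
induced-atMostTwo v R-atMostTwo to p q r = R-atMostTwo (to _ _ p) (to _ _ q) (to _ _ r)

snakePath-upper : ∀ {m n k} → 1 ≤ n → SnakePath m n k → 3 * k ≤ 2 * (m * n) + 6 * (m + n)
snakePath-upper {m} {n} {k} 1≤n P = begin
  3 * k                         ≤⟨ *-monoʳ-≤ 3 (n≤1+n k) ⟩
  3 * suc k                     ≤⟨ TokenCount.three-tokens-each vertex inGrid distinct
                                     (induced-atMostTwo vertex pathNbr-atMostTwo
                                        (λ i j → Equivalence.to (induced i j))) ⟩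
  suc m * suc (suc n) * 2       ≤⟨ token-box≤ m n 1≤n ⟩
  2 * (m * n) + 6 * (m + n)     ∎
  where
  open SnakePath P
  open ≤-Reasoning

snakeCycle-upper : ∀ {m n k} → 1 ≤ n → SnakeCycle m n k → 3 * k ≤ 2 * (m * n) + 6 * (m + n)
snakeCycle-upper {m} {n} {k} 1≤n C = ≤-trans
  (TokenCount.three-tokens-each vertex inGrid distinct
     (induced-atMostTwo vertex cycNbr-atMostTwo (λ i j → Equivalence.to (induced i j))))
  (token-box≤ m n 1≤n)
  where open SnakeCycle C

-- Induced chains

Far : Cell → Cell → Set
Far c d = c ≢ d × ¬ Adj c d

far-sym : ∀ {c d} → Far c d → Far d c
far-sym (c≢d , ¬adj) = (λ e → c≢d (sym e)) , (λ a → ¬adj (adj-sym a))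

far-byGap : ∀ {c d a b} → (c ≡ d → a ≤ b) → (Adj c d → a ≤ suc b) → suc (suc b) ≤ a → Far c d
far-byGap same step gap = (λ e → 1+n≰n (≤-trans (≤-trans (n≤1+n _) gap) (same e)))
                        , (λ a → 1+n≰n (≤-trans gap (step a)))

level : Cell → ℕ
level (x , y) = x + y

-- cross c d ≤ cross d c compares x - y on c and d without subtracting.
cross : Cell → Cell → ℕ
cross (x , _) (_ , y) = x + y

adj-level : ∀ {c d} → Adj c d → level c ≤ suc (level d)
adj-level {x , y} (inj₁ (refl , inj₁ refl)) = ≤-trans (+-monoʳ-≤ x (n≤1+n y)) (n≤1+n _)
adj-level {x , _} (inj₁ (refl , inj₂ refl)) = ≤-reflexive (+-suc x _)
adj-level (inj₂ (refl , inj₁ refl)) = ≤-trans (n≤1+n _) (n≤1+n _)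
adj-level (inj₂ (refl , inj₂ refl)) = ≤-refl

adj-cross : ∀ {c d} → Adj c d → cross c d ≤ suc (cross d c)
adj-cross {x , y} (inj₁ (refl , inj₁ refl)) = ≤-reflexive (+-suc x y)
adj-cross {x , _} (inj₁ (refl , inj₂ refl)) = ≤-trans (+-monoʳ-≤ x (n≤1+n _)) (n≤1+n _)
adj-cross (inj₂ (refl , inj₁ refl)) = ≤-trans (n≤1+n _) (n≤1+n _)
adj-cross (inj₂ (refl , inj₂ refl)) = ≤-refl

adj-x : ∀ {c d} → Adj c d → proj₁ c ≤ suc (proj₁ d)
adj-x (inj₁ (refl , _)) = n≤1+n _
adj-x (inj₂ (refl , inj₁ refl)) = ≤-trans (n≤1+n _) (n≤1+n _)
adj-x (inj₂ (refl , inj₂ refl)) = ≤-refl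

adj-y : ∀ {c d} → Adj c d → proj₂ c ≤ suc (proj₂ d)
adj-y (inj₂ (refl , _)) = n≤1+n _
adj-y (inj₁ (refl , inj₁ refl)) = ≤-trans (n≤1+n _) (n≤1+n _)
adj-y (inj₁ (refl , inj₂ refl)) = ≤-refl

far-level : ∀ c d → suc (suc (level d)) ≤ level c → Far c d
far-level c d = far-byGap (λ { refl → ≤-refl }) adj-level

far-cross : ∀ c d → suc (suc (cross d c)) ≤ cross c d → Far c d
far-cross c d = far-byGap (λ { refl → ≤-refl }) adj-cross

far-x : ∀ c d → suc (suc (proj₁ d)) ≤ proj₁ c → Far c d
far-x c d = far-byGap (λ { refl → ≤-refl }) adj-x

far-y : ∀ c d → suc (suc (proj₂ d)) ≤ proj₂ c → Far c d
far-y c d = far-byGap (λ { refl → ≤-refl }) adj-y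

far-cross′ : ∀ c d → suc (suc (cross c d)) ≤ cross d c → Far c d
far-cross′ c d gap = far-sym (far-cross d c gap)

far-level′ : ∀ c d → suc (suc (level c)) ≤ level d → Far c d
far-level′ c d gap = far-sym (far-level d c gap)

far-x′ : ∀ c d → suc (suc (proj₁ c)) ≤ proj₁ d → Far c d
far-x′ c d gap = far-sym (far-x d c gap)

data Chain : Cell → List Cell → Set where
  start  : ∀ c → Chain c []
  extend : ∀ {h t} c → Adj c h → All (Far c) t → Chain h t → Chain c (h ∷ t)

chainEnd : Cell → List Cell → Cell
chainEnd h []      = h
chainEnd _ (d ∷ t) = chainEnd d t

lookup-chainEnd : ∀ h t → lookup (h ∷ t) (fromℕ (length t)) ≡ chainEnd h t
lookup-chainEnd h []      = refl
lookup-chainEnd h (d ∷ t) = lookup-chainEnd d t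

All-lookup : ∀ {P : Cell → Set} {cs} → All P cs → ∀ i → P (lookup cs i)
All-lookup ps i = All.lookup ps (∈-lookup i)

chain-injective : ∀ {h t} → Chain h t → ∀ i j → lookup (h ∷ t) i ≡ lookup (h ∷ t) j → i ≡ j
chain-injective _ 0F 0F _ = refl
chain-injective (extend c a _ _) 0F 1F e = ⊥-elim (adj-irrefl (subst (Adj c) (sym e) a))
chain-injective (extend c a _ _) 1F 0F e = ⊥-elim (adj-irrefl (subst (Adj c) e a))
chain-injective (extend c _ f _) 0F (Fin.suc (Fin.suc j)) e = ⊥-elim (proj₁ (All-lookup f j) e)
chain-injective (extend c _ f _) (Fin.suc (Fin.suc i)) 0F e = ⊥-elim (proj₁ (All-lookup f i) (sym e))
chain-injective (extend c _ _ ch) (Fin.suc i) (Fin.suc j) e = cong Fin.suc (chain-injective ch i j e)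

chain-adj⇒nbr : ∀ {h t} → Chain h t → ∀ i j → Adj (lookup (h ∷ t) i) (lookup (h ∷ t) j) → PathNbr i j
chain-adj⇒nbr _ 0F 0F a = ⊥-elim (adj-irrefl a)
chain-adj⇒nbr (extend _ _ _ _) 0F 1F _ = inj₁ refl
chain-adj⇒nbr (extend _ _ _ _) 1F 0F _ = inj₂ refl
chain-adj⇒nbr (extend _ _ f _) 0F (Fin.suc (Fin.suc j)) a = ⊥-elim (proj₂ (All-lookup f j) a)
chain-adj⇒nbr (extend _ _ f _) (Fin.suc (Fin.suc i)) 0F a = ⊥-elim (proj₂ (All-lookup f i) (adj-sym a))
chain-adj⇒nbr (extend _ _ _ ch) (Fin.suc i) (Fin.suc j) a with chain-adj⇒nbr ch i j a
... | inj₁ p = inj₁ (cong suc p)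
... | inj₂ p = inj₂ (cong suc p)

chain-nbr⇒adj : ∀ {h t} → Chain h t → ∀ i j → PathNbr i j → Adj (lookup (h ∷ t) i) (lookup (h ∷ t) j)
chain-nbr⇒adj (extend _ a _ _) 0F 1F _ = a
chain-nbr⇒adj (extend _ a _ _) 1F 0F _ = adj-sym a
chain-nbr⇒adj (extend _ _ _ ch) (Fin.suc i) (Fin.suc j) (inj₁ p) = chain-nbr⇒adj ch i j (inj₁ (suc-injective p))
chain-nbr⇒adj (extend _ _ _ ch) (Fin.suc i) (Fin.suc j) (inj₂ p) = chain-nbr⇒adj ch i j (inj₂ (suc-injective p))
chain-nbr⇒adj _ 0F 0F (inj₁ ())
chain-nbr⇒adj _ 0F 0F (inj₂ ())
chain-nbr⇒adj (extend _ _ _ _) 0F (Fin.suc (Fin.suc _)) (inj₁ ())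
chain-nbr⇒adj (extend _ _ _ _) 0F (Fin.suc (Fin.suc _)) (inj₂ ())
chain-nbr⇒adj (extend _ _ _ _) (Fin.suc (Fin.suc _)) 0F (inj₁ ())
chain-nbr⇒adj (extend _ _ _ _) (Fin.suc (Fin.suc _)) 0F (inj₂ ())

chain⇒snakePath : ∀ {m n h t} → Chain h t → All (InGrid m n) (h ∷ t) → SnakePath m n (length t)
chain⇒snakePath {h = h} {t} ch inGrid = record
  { vertex   = lookup (h ∷ t)
  ; inGrid   = All-lookup inGrid
  ; distinct = chain-injective ch
  ; induced  = λ i j → mk⇔ (chain-adj⇒nbr ch i j) (chain-nbr⇒adj ch i j)
  }

cycNbr-sym : ∀ {k} {i j : Fin k} → CycNbr k i j → CycNbr k j i
cycNbr-sym (inj₁ (inj₁ p)) = inj₁ (inj₂ p)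
cycNbr-sym (inj₁ (inj₂ p)) = inj₁ (inj₁ p)
cycNbr-sym (inj₂ (inj₁ p)) = inj₂ (inj₂ p)
cycNbr-sym (inj₂ (inj₂ p)) = inj₂ (inj₁ p)

chain⇒snakeCycle : ∀ {m n h t} (c : Cell) → Chain h t → Adj c h → Adj c (chainEnd h t) →
  All (λ d → Far c d ⊎ d ≡ chainEnd h t) t → 1 ≤ length t → All (InGrid m n) (c ∷ h ∷ t) →
  SnakeCycle m n (suc (suc (length t)))
chain⇒snakeCycle {m} {n} {h} {t} c ch c-h c-end c-far 1≤t inGrid = record
  { long     = s≤s (s≤s 1≤t)
  ; vertex   = lookup (c ∷ h ∷ t)
  ; inGrid   = All-lookup inGrid
  ; distinct = distinct
  ; induced  = λ i j → mk⇔ (adj⇒nbr i j) (nbr⇒adj i j)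
  }
  where
  K : ℕ
  K = suc (suc (length t))

  end-position : ∀ j → lookup (h ∷ t) j ≡ chainEnd h t → toℕ j ≡ length t
  end-position j e = trans (cong toℕ (chain-injective ch j _ (trans e (sym (lookup-chainEnd h t)))))
                           (Finₚ.toℕ-fromℕ (length t))

  c-adj⇒nbr : ∀ j → Adj c (lookup (c ∷ h ∷ t) j) → CycNbr K 0F j
  c-adj⇒nbr 0F a = ⊥-elim (adj-irrefl a)
  c-adj⇒nbr 1F _ = inj₁ (inj₁ refl)
  c-adj⇒nbr (Fin.suc (Fin.suc j)) a with All-lookup c-far j
  ... | inj₁ far = ⊥-elim (proj₂ far a)
  ... | inj₂ e   = inj₂ (inj₂ (cong (suc ∘ suc) (end-position (Fin.suc j) e) , refl))

  c-nbr⇒adj : ∀ j → CycNbr K 0F j → Adj c (lookup (c ∷ h ∷ t) j)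
  c-nbr⇒adj 1F _ = c-h
  c-nbr⇒adj (Fin.suc (Fin.suc j)) (inj₂ (inj₂ (w , _))) = subst (Adj c) end≡ c-end
    where
    end≡ : chainEnd h t ≡ lookup (h ∷ t) (Fin.suc j)
    end≡ = trans (sym (lookup-chainEnd h t)) (cong (lookup (h ∷ t))
             (Finₚ.toℕ-injective (trans (Finₚ.toℕ-fromℕ (length t)) (sym (suc-injective (suc-injective w))))))
  c-nbr⇒adj 0F (inj₁ (inj₁ ()))
  c-nbr⇒adj 0F (inj₁ (inj₂ ()))
  c-nbr⇒adj 0F (inj₂ (inj₁ (() , _)))
  c-nbr⇒adj 0F (inj₂ (inj₂ (() , _)))
  c-nbr⇒adj (Fin.suc (Fin.suc j)) (inj₁ (inj₁ ()))
  c-nbr⇒adj (Fin.suc (Fin.suc j)) (inj₁ (inj₂ ()))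
  c-nbr⇒adj (Fin.suc (Fin.suc j)) (inj₂ (inj₁ (() , _)))

  adj⇒nbr : ∀ i j → Adj (lookup (c ∷ h ∷ t) i) (lookup (c ∷ h ∷ t) j) → CycNbr K i j
  adj⇒nbr 0F j a = c-adj⇒nbr j a
  adj⇒nbr (Fin.suc i) 0F a = cycNbr-sym (c-adj⇒nbr (Fin.suc i) (adj-sym a))
  adj⇒nbr (Fin.suc i) (Fin.suc j) a with chain-adj⇒nbr ch i j a
  ... | inj₁ p = inj₁ (inj₁ (cong suc p))
  ... | inj₂ p = inj₁ (inj₂ (cong suc p))

  nbr⇒adj : ∀ i j → CycNbr K i j → Adj (lookup (c ∷ h ∷ t) i) (lookup (c ∷ h ∷ t) j)
  nbr⇒adj 0F j p = c-nbr⇒adj j p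
  nbr⇒adj (Fin.suc i) 0F p = adj-sym (c-nbr⇒adj (Fin.suc i) (cycNbr-sym p))
  nbr⇒adj (Fin.suc i) (Fin.suc j) (inj₁ (inj₁ p)) = chain-nbr⇒adj ch i j (inj₁ (suc-injective p))
  nbr⇒adj (Fin.suc i) (Fin.suc j) (inj₁ (inj₂ p)) = chain-nbr⇒adj ch i j (inj₂ (suc-injective p))
  nbr⇒adj (Fin.suc i) (Fin.suc j) (inj₂ (inj₁ (_ , ())))
  nbr⇒adj (Fin.suc i) (Fin.suc j) (inj₂ (inj₂ (_ , ())))

  c-fresh : ∀ j → c ≢ lookup (h ∷ t) j
  c-fresh 0F e = adj-irrefl (subst (Adj c) (sym e) c-h)
  c-fresh (Fin.suc j) e with All-lookup c-far j
  ... | inj₁ far = proj₁ far e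
  ... | inj₂ e′  = adj-irrefl (subst (Adj c) (trans (sym e′) (sym e)) c-end)

  distinct : ∀ i j → lookup (c ∷ h ∷ t) i ≡ lookup (c ∷ h ∷ t) j → i ≡ j
  distinct 0F 0F _ = refl
  distinct 0F (Fin.suc j) e = ⊥-elim (c-fresh j e)
  distinct (Fin.suc i) 0F e = ⊥-elim (c-fresh i (sym e))
  distinct (Fin.suc i) (Fin.suc j) e = cong Fin.suc (chain-injective ch i j e)

record Growing (origin : Cell) (P : Cell → Set) (h : Cell) (L : ℕ) : Set where
  field
    cells : List Cell
    chain : Chain h cells
    older : All P cells
    size  : length cells ≡ L
    ends  : chainEnd h cells ≡ origin

grow : ∀ {o P P′ h L} c → Growing o P h L → Adj c h → (∀ {d} → P d → Far c d) →
       P′ h → (∀ {d} → P d → P′ d) → Growing o P′ c (suc L)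
grow c g adj far new keep = record
  { cells = _ ∷ cells
  ; chain = extend c adj (All.map far older) chain
  ; older = new ∷ All.map keep older
  ; size  = cong suc size
  ; ends  = ends
  }
  where open Growing g

Growing-map : ∀ {o P P′ h L} → (∀ {d} → P d → P′ d) → Growing o P h L → Growing o P′ h L
Growing-map f g = record { Growing g; older = All.map f (Growing.older g) }

seed : ∀ c → Growing c (λ _ → ⊥) c 0
seed c = record { cells = [] ; chain = start c ; older = [] ; size = refl ; ends = refl }

moved-right : ∀ {x y} → Adj (suc x , y) (x , y)
moved-right = inj₂ (refl , inj₂ refl)

moved-left : ∀ {x y} → Adj (x , y) (suc x , y)
moved-left = inj₂ (refl , inj₁ refl)

moved-up : ∀ {x y} → Adj (x , suc y) (x , y)
moved-up = inj₁ (refl , inj₂ refl)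

moved-down : ∀ {x y} → Adj (x , y) (x , suc y)
moved-down = inj₁ (refl , inj₁ refl)

-- Staircases

Old : ℕ → Cell → Set
Old s d = suc (level d) ≤ s

old-far : ∀ {s c d} → Old s d → suc s ≤ level c → Far c d
old-far {c = c} {d} old s<c = far-level c d (≤-trans (s≤s old) s<c)

module Staircases (Q : Cell → Set) (origin : Cell) where

  Covers : ℕ → ℕ → ℕ → Set
  Covers x₀ x₁ y₁ = ∀ {x y} → x₀ ≤ x → x ≤ x₁ → y ≤ y₁ → Q (x , y)

  -- On a staircase running down-right (resp. up-left) from d to h, x - y grows (resp. shrinks).
  BehindDR BehindUL : Cell → Cell → Set
  BehindDR h d = suc (cross d h) ≤ cross h d
  BehindUL h d = suc (cross h d) ≤ cross d h

  -- A staircase grows on the diagonals of levels s + 1 and s + 2. Every cell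
  -- already laid is either Old, hence two levels below the new cells, or lies
  -- behind the head in the direction of travel; either way it is far from the next cell.
  Done : ℕ → Cell → Set
  Done s d = Q d × level d ≤ suc (suc s)

  Tail : ℕ → (Cell → Set) → Cell → Set
  Tail s Behind d = Done s d × (Old s d ⊎ Behind d)

  done : ∀ {s B d} → Tail s B d → Done s d
  done = proj₁

  staircase-size : ∀ j L → suc (j + j) + suc (suc L) ≡ suc (suc j + suc j) + L
  staircase-size = solve-∀

  staircaseDR : ∀ s x ye j {L} → level (x , j + ye) ≡ suc (suc s) → Q (x , j + ye) →
    Covers x (j + x) (j + ye) →
    Growing origin (Tail s (BehindDR (x , j + ye))) (x , j + ye) L →
    Growing origin (Done s) (suc (j + x) , ye) (suc (j + j) + L)
  staircaseDR s x ye zero level-h qh _ g = grow (suc x , ye) g moved-right far (qh , ≤-reflexive level-h) (done {B = BehindDR (x , ye)})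
    where
    far : ∀ {d} → Tail s (BehindDR (x , ye)) d → Far (suc x , ye) d
    far (_ , inj₁ old) = old-far old (≤-trans (≤-trans (n≤1+n _) (n≤1+n _)) (≤-reflexive (sym (cong suc level-h))))
    far {d} (_ , inj₂ b) = far-cross _ d (s≤s b)
  staircaseDR s x ye (suc j) {L} level-h qh covers g =
    subst₂ (Growing origin (Done s)) (cong (λ z → suc z , ye) (+-suc j x)) (staircase-size j L) rest
    where
    h c₁ c₂ : Cell
    h  = (x , suc (j + ye))
    c₁ = (x , j + ye)
    c₂ = (suc x , j + ye)

    level-c₁ : level c₁ ≡ suc s
    level-c₁ = suc-injective (trans (sym (+-suc x (j + ye))) level-h)

    g₁ : Growing origin (Tail s (BehindDR c₁)) c₁ (suc L)
    g₁ = grow c₁ g moved-down far ((qh , ≤-reflexive level-h) , inj₂ (≤-reflexive (sym (+-suc x (j + ye))))) keep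
      where
      far : ∀ {d} → Tail s (BehindDR h) d → Far c₁ d
      far (_ , inj₁ old) = old-far old (≤-reflexive (sym level-c₁))
      far {d} (_ , inj₂ b) = far-cross c₁ d (≤-trans (s≤s (≤-reflexive (sym (+-suc (proj₁ d) (j + ye))))) b)
      keep : ∀ {d} → Tail s (BehindDR h) d → Tail s (BehindDR c₁) d
      keep {d} (q , w) = q , Sum.map₂ (≤-trans (s≤s (+-monoʳ-≤ (proj₁ d) (n≤1+n _)))) w

    q₁ : Q c₁
    q₁ = covers ≤-refl (m≤n+m x (suc j)) (n≤1+n _)

    g₂ : Growing origin (Tail s (BehindDR c₂)) c₂ (suc (suc L))
    g₂ = grow c₂ g₁ moved-right far ((q₁ , ≤-trans (≤-reflexive level-c₁) (n≤1+n _)) , inj₂ ≤-refl) keep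
      where
      far : ∀ {d} → Tail s (BehindDR c₁) d → Far c₂ d
      far (_ , inj₁ old) = old-far old (≤-trans (n≤1+n _) (≤-reflexive (cong suc (sym level-c₁))))
      far {d} (_ , inj₂ b) = far-cross c₂ d (s≤s b)
      keep : ∀ {d} → Tail s (BehindDR c₁) d → Tail s (BehindDR c₂) d
      keep (q , w) = q , Sum.map₂ m≤n⇒m≤1+n w

    rest : Growing origin (Done s) (suc (j + suc x) , ye) (suc (j + j) + suc (suc L))
    rest = staircaseDR s (suc x) ye j (cong suc level-c₁)
      (covers (n≤1+n x) (s≤s (m≤n+m x j)) (n≤1+n _))
      (λ x≤ ≤x ≤y → covers (≤-trans (n≤1+n x) x≤) (≤-trans ≤x (≤-reflexive (+-suc j x))) (m≤n⇒m≤1+n ≤y))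
      g₂

  staircaseUL : ∀ s xe y j {L} → level (j + xe , y) ≡ suc (suc s) → Q (j + xe , y) →
    Covers xe (j + xe) (j + y) →
    Growing origin (Tail s (BehindUL (j + xe , y))) (j + xe , y) L →
    Growing origin (Done s) (xe , suc (j + y)) (suc (j + j) + L)
  staircaseUL s xe y zero level-h qh _ g =
    grow (xe , suc y) g moved-up far (qh , ≤-reflexive level-h) (done {B = BehindUL (xe , y)})
    where
    far : ∀ {d} → Tail s (BehindUL (xe , y)) d → Far (xe , suc y) d
    far (_ , inj₁ old) = old-far old (≤-trans (≤-trans (n≤1+n _) (n≤1+n _))
                                       (≤-reflexive (sym (trans (+-suc xe y) (cong suc level-h)))))
    far {d} (_ , inj₂ b) = far-cross′ _ d (≤-trans (s≤s b) (≤-reflexive (sym (+-suc (proj₁ d) y))))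
  staircaseUL s xe y (suc j) {L} level-h qh covers g =
    subst₂ (Growing origin (Done s)) (cong (λ z → xe , suc z) (+-suc j y)) (staircase-size j L) rest
    where
    h c₁ c₂ : Cell
    h  = (suc (j + xe) , y)
    c₁ = (j + xe , y)
    c₂ = (j + xe , suc y)

    level-c₁ : level c₁ ≡ suc s
    level-c₁ = suc-injective level-h

    level-c₂ : level c₂ ≡ suc (suc s)
    level-c₂ = trans (+-suc (j + xe) y) (cong suc level-c₁)

    g₁ : Growing origin (Tail s (BehindUL c₁)) c₁ (suc L)
    g₁ = grow c₁ g moved-left far ((qh , ≤-reflexive level-h) , inj₂ ≤-refl) keep
      where
      far : ∀ {d} → Tail s (BehindUL h) d → Far c₁ d
      far (_ , inj₁ old) = old-far old (≤-reflexive (sym level-c₁))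
      far {d} (_ , inj₂ b) = far-cross′ c₁ d b
      keep : ∀ {d} → Tail s (BehindUL h) d → Tail s (BehindUL c₁) d
      keep (q , w) = q , Sum.map₂ (≤-trans (n≤1+n _)) w

    q₁ : Q c₁
    q₁ = covers (m≤n+m xe j) (n≤1+n _) (m≤n+m y (suc j))

    g₂ : Growing origin (Tail s (BehindUL c₂)) c₂ (suc (suc L))
    g₂ = grow c₂ g₁ moved-up far
           ((q₁ , ≤-trans (≤-reflexive level-c₁) (n≤1+n _)) , inj₂ (≤-reflexive (sym (+-suc (j + xe) y))))
           keep
      where
      far : ∀ {d} → Tail s (BehindUL c₁) d → Far c₂ d
      far (_ , inj₁ old) = old-far old (≤-trans (n≤1+n _) (≤-reflexive (sym level-c₂)))
      far {d} (_ , inj₂ b) = far-cross′ c₂ d (≤-trans (s≤s b) (≤-reflexive (sym (+-suc (proj₁ d) y))))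
      keep : ∀ {d} → Tail s (BehindUL c₁) d → Tail s (BehindUL c₂) d
      keep {d} (q , w) = q , Sum.map₂ (λ b → ≤-trans b (≤-trans (n≤1+n _) (≤-reflexive (sym (+-suc (proj₁ d) y))))) w

    rest : Growing origin (Done s) (xe , suc (j + suc y)) (suc (j + j) + suc (suc L))
    rest = staircaseUL s xe (suc y) j level-c₂
      (covers (m≤n+m xe j) (n≤1+n _) (s≤s (m≤n+m y j)))
      (λ x≤ ≤x ≤y → covers x≤ (m≤n⇒m≤1+n ≤x) (≤-trans ≤y (≤-reflexive (+-suc j y))))
      g₂

  Below : Cell → Cell → Set
  Below h d = Q d × Old (level h) d

  Snake : Cell → ℕ → Set
  Snake h L = Q h × Growing origin (Below h) h L

  diagonalDR : ∀ x₀ ye k {L} → Covers x₀ (k + suc (suc x₀)) (k + ye) → Snake (x₀ , k + ye) L →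
    let h = (suc (k + suc (suc x₀)) , ye) in Growing origin (Below h) h (suc (k + k) + suc (suc L))
  diagonalDR x₀ ye k {L} covers (qh , g) = Growing-map below stairs
    where
    s : ℕ
    s = level (x₀ , k + ye)
    h₀ c₁ c₂ : Cell
    h₀ = (x₀ , k + ye)
    c₁ = (suc x₀ , k + ye)
    c₂ = (suc (suc x₀) , k + ye)

    q₁ : Q c₁
    q₁ = covers (n≤1+n _) (≤-trans (n≤1+n _) (m≤n+m _ k)) ≤-refl

    g₁ : Growing origin (λ d → Below h₀ d ⊎ d ≡ h₀) c₁ (suc L)
    g₁ = grow c₁ g moved-right (λ (_ , old) → old-far old ≤-refl) (inj₂ refl) inj₁

    g₂ : Growing origin (Tail s (BehindDR c₂)) c₂ (suc (suc L))
    g₂ = grow c₂ g₁ moved-right far ((q₁ , n≤1+n _) , inj₂ ≤-refl) keep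
      where
      far : ∀ {d} → Below h₀ d ⊎ d ≡ h₀ → Far c₂ d
      far (inj₁ (_ , old)) = old-far old (n≤1+n _)
      far (inj₂ refl)      = far-level c₂ h₀ ≤-refl
      keep : ∀ {d} → Below h₀ d ⊎ d ≡ h₀ → Tail s (BehindDR c₂) d
      keep (inj₁ (q , old)) = (q , ≤-trans (≤-trans (n≤1+n _) old) (≤-trans (n≤1+n _) (n≤1+n _))) , inj₁ old
      keep (inj₂ refl)      = (qh , ≤-trans (n≤1+n _) (n≤1+n _)) , inj₂ (n≤1+n _)

    stairs : Growing origin (Done s) (suc (k + suc (suc x₀)) , ye) (suc (k + k) + suc (suc L))
    stairs = staircaseDR s (suc (suc x₀)) ye k refl
      (covers (≤-trans (n≤1+n _) (n≤1+n _)) (m≤n+m _ k) ≤-refl)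
      (λ x≤ ≤x ≤y → covers (≤-trans (≤-trans (n≤1+n _) (n≤1+n _)) x≤) ≤x ≤y)
      g₂

    below : ∀ {d} → Done s d → Below (suc (k + suc (suc x₀)) , ye) d
    below (q , le) = q , ≤-trans (s≤s le) (≤-reflexive (sym (level-end k x₀ ye)))
      where
      level-end : ∀ k x₀ ye → suc (k + suc (suc x₀)) + ye ≡ suc (suc (suc (x₀ + (k + ye))))
      level-end = solve-∀

  diagonalUL : ∀ xe y₀ k {L} → Covers xe (k + xe) (k + suc (suc y₀)) → Snake (k + xe , y₀) L →
    let h = (xe , suc (k + suc (suc y₀))) in Growing origin (Below h) h (suc (k + k) + suc (suc L))
  diagonalUL xe y₀ k {L} covers (qh , g) = Growing-map below stairs
    where
    X s : ℕ
    X = k + xe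
    s = level (X , y₀)
    h₀ c₁ c₂ : Cell
    h₀ = (X , y₀)
    c₁ = (X , suc y₀)
    c₂ = (X , suc (suc y₀))

    level-c₁ : level c₁ ≡ suc s
    level-c₁ = +-suc X y₀

    level-c₂ : level c₂ ≡ suc (suc s)
    level-c₂ = trans (+-suc X (suc y₀)) (cong suc level-c₁)

    q₁ : Q c₁
    q₁ = covers (m≤n+m xe k) ≤-refl (≤-trans (n≤1+n _) (m≤n+m _ k))

    g₁ : Growing origin (λ d → Below h₀ d ⊎ d ≡ h₀) c₁ (suc L)
    g₁ = grow c₁ g moved-up (λ (_ , old) → old-far old (≤-reflexive (sym level-c₁))) (inj₂ refl) inj₁

    g₂ : Growing origin (Tail s (BehindUL c₂)) c₂ (suc (suc L))
    g₂ = grow c₂ g₁ moved-up far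
           ((q₁ , ≤-trans (≤-reflexive level-c₁) (n≤1+n _)) , inj₂ (≤-reflexive (sym (+-suc X (suc y₀)))))
           keep
      where
      far : ∀ {d} → Below h₀ d ⊎ d ≡ h₀ → Far c₂ d
      far (inj₁ (_ , old)) = old-far old (≤-trans (n≤1+n _) (≤-reflexive (sym level-c₂)))
      far (inj₂ refl)      = far-level c₂ h₀ (≤-reflexive (sym level-c₂))
      keep : ∀ {d} → Below h₀ d ⊎ d ≡ h₀ → Tail s (BehindUL c₂) d
      keep (inj₁ (q , old)) = (q , ≤-trans (≤-trans (n≤1+n _) old) (≤-trans (n≤1+n _) (n≤1+n _))) , inj₁ old
      keep (inj₂ refl)      = (qh , ≤-trans (n≤1+n _) (n≤1+n _)) ,
                              inj₂ (≤-trans (≤-reflexive (sym (+-suc X y₀))) (+-monoʳ-≤ X (n≤1+n _)))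

    stairs : Growing origin (Done s) (xe , suc (k + suc (suc y₀))) (suc (k + k) + suc (suc L))
    stairs = staircaseUL s xe (suc (suc y₀)) k level-c₂
      (covers (m≤n+m xe k) ≤-refl (m≤n+m _ k))
      covers
      g₂

    below : ∀ {d} → Done s d → Below (xe , suc (k + suc (suc y₀))) d
    below (q , le) = q , ≤-trans (s≤s le) (≤-reflexive (sym (level-end k xe y₀)))
      where
      level-end : ∀ k xe y₀ → xe + suc (k + suc (suc y₀)) ≡ suc (suc (suc ((k + xe) + y₀)))
      level-end = solve-∀

-- The construction

≤-by : ∀ {a b} w → a + w ≡ b → a ≤ b
≤-by {a} w e = subst (a ≤_) e (m≤m+n a w)

-- The snake starts at origin and sweeps the body [0, right-edge] × [0, top] by
-- staircases alternately climbing up-left and descending down-right. Their ends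
-- lie on the bottom row and the column x = 2 in regime A, on the bottom and top
-- rows in regime B, and on the right column and the top row in regime C. The
-- last staircase ends on the buffer cell just above the body, from where the
-- snake returns along the row two above the body and down the column x = 0 to (0, 8),
-- which together with origin is a neighbour of (0, 7).
module Construction (p β : ℕ) where

  right-edge top : ℕ
  right-edge = 6 * p + 6 * β + 18
  top        = 6 * p + 13

  origin : Cell
  origin = (1 , 7)

  Body : Cell → Set
  Body d = proj₁ d ≤ right-edge × proj₂ d ≤ top × (2 ≤ proj₁ d ⊎ d ≡ origin)

  open Staircases Body origin

  move : ∀ {x y x′ y′ L L′} → Snake (x , y) L → x ≡ x′ → y ≡ y′ → L ≡ L′ → Snake (x′ , y′) L′
  move s refl refl refl = s

  inBody : ∀ {x₀ x₁ y₁} → 2 ≤ x₀ → x₁ ≤ right-edge → y₁ ≤ top → Covers x₀ x₁ y₁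
  inBody 2≤x₀ x₁≤ y₁≤ x₀≤x x≤x₁ y≤y₁ = ≤-trans x≤x₁ x₁≤ , ≤-trans y≤y₁ y₁≤ , inj₁ (≤-trans 2≤x₀ x₀≤x)

  runDR : ∀ x₀ ye k {L} → 2 ≤ x₀ → suc (k + suc (suc x₀)) ≤ right-edge → k + ye ≤ top →
          Snake (x₀ , k + ye) L → Snake (suc (k + suc (suc x₀)) , ye) (suc (k + k) + suc (suc L))
  runDR x₀ ye k 2≤x₀ x≤ y≤ s =
    (x≤ , ≤-trans (m≤n+m ye k) y≤ , inj₁ (≤-trans 2≤x₀ (≤-trans (≤-trans (n≤1+n _) (n≤1+n _)) (m≤n+m _ (suc k))))) ,
    diagonalDR x₀ ye k (inBody 2≤x₀ (≤-trans (n≤1+n _) x≤) y≤) s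

  runUL : ∀ xe y₀ k {L} → 2 ≤ xe → k + xe ≤ right-edge → suc (k + suc (suc y₀)) ≤ top →
          Snake (k + xe , y₀) L → Snake (xe , suc (k + suc (suc y₀))) (suc (k + k) + suc (suc L))
  runUL xe y₀ k 2≤xe x≤ y≤ s =
    (≤-trans (m≤n+m xe k) x≤ , y≤ , inj₁ 2≤xe) ,
    diagonalUL xe y₀ k (inBody 2≤xe x≤ (≤-trans (n≤1+n _) y≤)) s

  x≤right-edge : ∀ {x} → x ≤ 18 → x ≤ right-edge
  x≤right-edge x≤ = ≤-trans x≤ (m≤n+m 18 (6 * p + 6 * β))

  y≤top : ∀ {y} → y ≤ 13 → y ≤ top
  y≤top y≤ = ≤-trans y≤ (m≤n+m 13 (6 * p))

  first : Snake (10 , 0) 16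
  first = (x≤right-edge (m≤m+n 10 8) , z≤n , inj₁ (m≤n+m 2 8)) , Growing-map (λ (q , le) → q , s≤s le) stairs
    where
    origin-tail : Tail 7 (BehindDR (2 , 7)) origin
    origin-tail = ((x≤right-edge (m≤m+n 1 17) , y≤top (m≤m+n 7 6) , inj₂ refl) , n≤1+n 8) , inj₂ ≤-refl

    stairs : Growing origin (Done 7) (10 , 0) 16
    stairs = staircaseDR 7 2 0 7 refl
      (x≤right-edge (m≤m+n 2 16) , y≤top (m≤m+n 7 6) , inj₁ ≤-refl)
      (inBody ≤-refl (x≤right-edge (m≤m+n 9 9)) (y≤top (m≤m+n 7 6)))
      (grow (2 , 7) (seed origin) moved-right (λ ()) origin-tail (λ ()))

  roundA : ∀ i {L} → 6 * suc i + 4 ≤ right-edge → 6 * i + 5 ≤ top →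
           Snake (6 * i + 4 , 0) L → Snake (6 * suc i + 4 , 0) (24 * i + 20 + L)
  roundA i {L} x≤ y≤ s = move descend (end-x i) refl refl
    where
    start-x : ∀ i → 6 * i + 4 ≡ (6 * i + 2) + 2
    start-x = solve-∀
    corner-y : ∀ i → suc ((6 * i + 2) + 2) ≡ 6 * i + 5
    corner-y = solve-∀
    end-x : ∀ i → suc ((6 * i + 5) + 4) ≡ 6 * suc i + 4
    end-x = solve-∀
    size-up : ∀ i L → suc ((6 * i + 2) + (6 * i + 2)) + suc (suc L) ≡ 12 * i + 7 + L
    size-up = solve-∀
    size-down : ∀ i L → suc ((6 * i + 5) + (6 * i + 5)) + suc (suc (12 * i + 7 + L)) ≡ 24 * i + 20 + L
    size-down = solve-∀

    climb-x : ∀ i → ((6 * i + 2) + 2) + 6 ≡ 6 * suc i + 4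
    climb-x = solve-∀

    climb : Snake (2 , 6 * i + 5) (12 * i + 7 + L)
    climb = move (runUL 2 0 (6 * i + 2) ≤-refl (≤-trans (≤-by 6 (climb-x i)) x≤)
                   (≤-trans (≤-reflexive (corner-y i)) y≤) (move s (start-x i) refl refl))
              refl (corner-y i) (size-up i L)

    descend : Snake (suc ((6 * i + 5) + 4) , 0) (24 * i + 20 + L)
    descend = move (runDR 2 0 (6 * i + 5) ≤-refl (≤-trans (≤-reflexive (end-x i)) x≤)
                     (≤-trans (≤-reflexive (+-identityʳ _)) y≤) (move climb refl (sym (+-identityʳ _)) refl))
                refl refl (size-down i L)

  lengthA : ℕ → ℕ → ℕ
  lengthA i r = 24 * r * i + 12 * r * r + 8 * r

  regimeA : ∀ i r {L} → 6 * (r + i) + 4 ≤ right-edge → 6 * (r + i) ≤ top →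
            Snake (6 * i + 4 , 0) L → Snake (6 * (r + i) + 4 , 0) (lengthA i r + L)
  regimeA i zero _ _ s = s
  regimeA i (suc r) {L} x≤ y≤ s =
    move (roundA (r + i) x≤ (≤-trans (≤-by 1 (top-gap (r + i))) y≤)
           (regimeA i r (≤-trans (+-monoˡ-≤ 4 (*-monoʳ-≤ 6 (n≤1+n _))) x≤)
                        (≤-trans (*-monoʳ-≤ 6 (n≤1+n _)) y≤) s))
         refl refl (size i r L)
    where
    top-gap : ∀ q → 6 * q + 5 + 1 ≡ 6 * suc q
    top-gap = solve-∀
    size : ∀ i r L → 24 * (r + i) + 20 + ((24 * r * i + 12 * r * r + 8 * r) + L)
                   ≡ (24 * suc r * i + 12 * suc r * suc r + 8 * suc r) + L
    size = solve-∀

  roundB : ∀ j {L} → 6 * p + 6 * suc j + 16 ≤ right-edge →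
           Snake (6 * p + 6 * j + 16 , 0) L → Snake (6 * p + 6 * suc j + 16 , 0) (24 * p + 52 + L)
  roundB j {L} x≤ s = move descend (end-x p j) refl refl
    where
    start-x : ∀ p j → 6 * p + 6 * j + 16 ≡ (6 * p + 10) + (6 * j + 6)
    start-x = solve-∀
    climb-x : ∀ p j → ((6 * p + 10) + (6 * j + 6)) + 6 ≡ 6 * p + 6 * suc j + 16
    climb-x = solve-∀
    corner-y : ∀ p → suc ((6 * p + 10) + 2) ≡ 6 * p + 13
    corner-y = solve-∀
    end-x : ∀ p j → suc ((6 * p + 13) + suc (suc (6 * j + 6))) ≡ 6 * p + 6 * suc j + 16
    end-x = solve-∀
    size-up : ∀ p L → suc ((6 * p + 10) + (6 * p + 10)) + suc (suc L) ≡ 12 * p + 23 + L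
    size-up = solve-∀
    size-down : ∀ p L → suc ((6 * p + 13) + (6 * p + 13)) + suc (suc (12 * p + 23 + L)) ≡ 24 * p + 52 + L
    size-down = solve-∀

    2≤x : 2 ≤ 6 * j + 6
    2≤x = ≤-trans (m≤m+n 2 4) (m≤n+m 6 (6 * j))

    climb : Snake (6 * j + 6 , top) (12 * p + 23 + L)
    climb = move (runUL (6 * j + 6) 0 (6 * p + 10) 2≤x (≤-trans (≤-by 6 (climb-x p j)) x≤)
                   (≤-reflexive (corner-y p)) (move s (start-x p j) refl refl))
              refl (corner-y p) (size-up p L)

    descend : Snake (suc ((6 * p + 13) + suc (suc (6 * j + 6))) , 0) (24 * p + 52 + L)
    descend = move (runDR (6 * j + 6) 0 (6 * p + 13) 2≤x (≤-trans (≤-reflexive (end-x p j)) x≤)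
                     (≤-reflexive (+-identityʳ _)) (move climb refl (sym (+-identityʳ _)) refl))
                refl refl (size-down p L)

  regimeB : ∀ r {L} → 6 * p + 6 * r + 16 ≤ right-edge →
            Snake (6 * p + 6 * 0 + 16 , 0) L → Snake (6 * p + 6 * r + 16 , 0) (r * (24 * p + 52) + L)
  regimeB zero _ s = s
  regimeB (suc r) {L} x≤ s =
    move (roundB r x≤ (regimeB r (≤-trans (+-monoˡ-≤ 16 (+-monoʳ-≤ (6 * p) (*-monoʳ-≤ 6 (n≤1+n r)))) x≤) s))
         refl refl (sym (+-assoc (24 * p + 52) (r * (24 * p + 52)) L))

  transit : ∀ {L} → Snake (6 * p + 6 * β + 16 , 0) L → Snake (right-edge , 4) (24 * p + 44 + L)
  transit {L} s = move descend (end-x p β) refl refl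
    where
    start-x : ∀ p β → 6 * p + 6 * β + 16 ≡ (6 * p + 10) + (6 * β + 6)
    start-x = solve-∀
    climb-x : ∀ p β → ((6 * p + 10) + (6 * β + 6)) + 2 ≡ 6 * p + 6 * β + 18
    climb-x = solve-∀
    corner-y : ∀ p → suc ((6 * p + 10) + 2) ≡ (6 * p + 9) + 4
    corner-y = solve-∀
    end-x : ∀ p β → suc ((6 * p + 9) + suc (suc (6 * β + 6))) ≡ 6 * p + 6 * β + 18
    end-x = solve-∀
    size-up : ∀ p L → suc ((6 * p + 10) + (6 * p + 10)) + suc (suc L) ≡ 12 * p + 23 + L
    size-up = solve-∀
    size-down : ∀ p L → suc ((6 * p + 9) + (6 * p + 9)) + suc (suc (12 * p + 23 + L)) ≡ 24 * p + 44 + L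
    size-down = solve-∀
    top-split : ∀ p → (6 * p + 9) + 4 ≡ 6 * p + 13
    top-split = solve-∀

    2≤x : 2 ≤ 6 * β + 6
    2≤x = ≤-trans (m≤m+n 2 4) (m≤n+m 6 (6 * β))

    climb : Snake (6 * β + 6 , (6 * p + 9) + 4) (12 * p + 23 + L)
    climb = move (runUL (6 * β + 6) 0 (6 * p + 10) 2≤x (≤-by 2 (climb-x p β))
                   (≤-reflexive (trans (corner-y p) (top-split p))) (move s (start-x p β) refl refl))
              refl (corner-y p) (size-up p L)

    descend : Snake (suc ((6 * p + 9) + suc (suc (6 * β + 6))) , 4) (24 * p + 44 + L)
    descend = move (runDR (6 * β + 6) 4 (6 * p + 9) 2≤x (≤-reflexive (end-x p β))
                     (≤-reflexive (top-split p)) climb)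
                refl refl (size-down p L)

  roundC : ∀ j r {L} → j + suc r ≡ p →
           Snake (right-edge , 6 * j + 4) L → Snake (right-edge , 6 * suc j + 4) (24 * r + 48 + L)
  roundC j r {L} E s = move descend (trans (end-x j r β) (cong (λ q → 6 * q + 6 * β + 18) E)) (end-y j) refl
    where
    edge-split : ∀ j r β → 6 * (j + suc r) + 6 * β + 18 ≡ (6 * r + 12) + (6 * j + 6 * β + 12)
    edge-split = solve-∀
    corner-y : ∀ j r → suc ((6 * r + 12) + suc (suc (6 * j + 4))) ≡ 6 * (j + suc r) + 13
    corner-y = solve-∀
    top-split : ∀ j r → 6 * (j + suc r) + 13 ≡ (6 * r + 9) + (6 * j + 10)
    top-split = solve-∀
    end-x : ∀ j r β → suc ((6 * r + 9) + suc (suc (6 * j + 6 * β + 12))) ≡ 6 * (j + suc r) + 6 * β + 18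
    end-x = solve-∀
    end-y : ∀ j → 6 * j + 10 ≡ 6 * suc j + 4
    end-y = solve-∀
    size-up : ∀ r L → suc ((6 * r + 12) + (6 * r + 12)) + suc (suc L) ≡ 12 * r + 27 + L
    size-up = solve-∀
    size-down : ∀ r L → suc ((6 * r + 9) + (6 * r + 9)) + suc (suc (12 * r + 27 + L)) ≡ 24 * r + 48 + L
    size-down = solve-∀

    edge≡ : right-edge ≡ (6 * r + 12) + (6 * j + 6 * β + 12)
    edge≡ = trans (cong (λ q → 6 * q + 6 * β + 18) (sym E)) (edge-split j r β)

    corner≡ : suc ((6 * r + 12) + suc (suc (6 * j + 4))) ≡ top
    corner≡ = trans (corner-y j r) (cong (λ q → 6 * q + 13) E)

    2≤x : 2 ≤ 6 * j + 6 * β + 12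
    2≤x = ≤-trans (m≤m+n 2 10) (m≤n+m 12 (6 * j + 6 * β))

    climb : Snake (6 * j + 6 * β + 12 , (6 * r + 9) + (6 * j + 10)) (12 * r + 27 + L)
    climb = move (runUL (6 * j + 6 * β + 12) (6 * j + 4) (6 * r + 12) 2≤x (≤-reflexive (sym edge≡))
                   (≤-reflexive corner≡) (move s edge≡ refl refl))
              refl (trans (corner-y j r) (top-split j r)) (size-up r L)

    descend : Snake (suc ((6 * r + 9) + suc (suc (6 * j + 6 * β + 12))) , 6 * j + 10) (24 * r + 48 + L)
    descend = move (runDR (6 * j + 6 * β + 12) (6 * j + 10) (6 * r + 9) 2≤x
                     (≤-reflexive (trans (end-x j r β) (cong (λ q → 6 * q + 6 * β + 18) E)))
                     (≤-reflexive (trans (sym (top-split j r)) (cong (λ q → 6 * q + 13) E))) climb)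
                refl refl (size-down r L)

  lengthC : ℕ → ℕ
  lengthC r = 12 * r * r + 36 * r

  regimeC : ∀ j r {L} → j + r ≡ p → Snake (right-edge , 6 * j + 4) L → Snake (right-edge , 6 * p + 4) (lengthC r + L)
  regimeC j zero E s = move s refl (cong (λ q → 6 * q + 4) (trans (sym (+-identityʳ j)) E)) refl
  regimeC j (suc r) {L} E s =
    move (regimeC (suc j) r (trans (sym (+-suc j r)) E) (roundC j r E s)) refl refl (size r L)
    where
    size : ∀ r L → (12 * r * r + 36 * r) + (24 * r + 48 + L) ≡ (12 * suc r * suc r + 36 * suc r) + L
    size = solve-∀

  bodyLength : ℕ
  bodyLength = lengthC p + (24 * p + 44 + (β * (24 * p + 52) + (lengthA 1 (suc p) + 16)))

  body : Snake (right-edge , 6 * p + 4) bodyLength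
  body = regimeC 0 p refl (transit (regimeB β (≤-by 2 (regimeB-x p β))
           (move (regimeA 1 (suc p) (≤-by (6 * β + 2) (regimeA-x p β)) (≤-by 1 (regimeA-y p)) first)
                 (regimeA-end p) refl refl)))
    where
    regimeA-x : ∀ p β → 6 * (suc p + 1) + 4 + (6 * β + 2) ≡ 6 * p + 6 * β + 18
    regimeA-x = solve-∀
    regimeA-y : ∀ p → 6 * (suc p + 1) + 1 ≡ 6 * p + 13
    regimeA-y = solve-∀
    regimeA-end : ∀ p → 6 * (suc p + 1) + 4 ≡ 6 * p + 6 * 0 + 16
    regimeA-end = solve-∀
    regimeB-x : ∀ p β → 6 * p + 6 * β + 16 + 2 ≡ 6 * p + 6 * β + 18
    regimeB-x = solve-∀

  ceiling : ℕ
  ceiling = suc (suc top)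

  buffer : Cell
  buffer = (6 * p + 6 * β + 11 , suc top)

  2≤buffer : 2 ≤ proj₁ buffer
  2≤buffer = ≤-trans (m≤m+n 2 9) (m≤n+m 11 (6 * p + 6 * β))

  buffer≤right-edge : proj₁ buffer ≤ right-edge
  buffer≤right-edge = ≤-by 7 (edge p β)
    where
    edge : ∀ p β → 6 * p + 6 * β + 11 + 7 ≡ 6 * p + 6 * β + 18
    edge = solve-∀

  leaveBody : Growing origin (Below buffer) buffer (suc (7 + 7) + suc (suc bodyLength))
  leaveBody = subst (λ h → Growing origin (Below h) h (suc (7 + 7) + suc (suc bodyLength))) (cong (proj₁ buffer ,_) (exit-y p))
           (diagonalUL (proj₁ buffer) (6 * p + 4) 7
              (inBody 2≤buffer (≤-reflexive (sym (edge p β))) (≤-reflexive (climb-y p)))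
              (move body (edge p β) refl refl))
    where
    edge : ∀ p β → 6 * p + 6 * β + 18 ≡ 7 + (6 * p + 6 * β + 11)
    edge = solve-∀
    climb-y : ∀ p → 7 + suc (suc (6 * p + 4)) ≡ 6 * p + 13
    climb-y = solve-∀
    exit-y : ∀ p → suc (7 + suc (suc (6 * p + 4))) ≡ suc (6 * p + 13)
    exit-y = solve-∀

  InBox : Cell → Set
  InBox d = proj₁ d ≤ right-edge × proj₂ d ≤ ceiling

  Return : Cell → Cell → Set
  Return h d = InBox d × (Body d ⊎ d ≡ buffer ⊎ suc (level h) ≤ level d)

  body-inBox : ∀ {d} → Body d → InBox d
  body-inBox (x≤ , y≤ , _) = x≤ , ≤-trans y≤ (≤-trans (n≤1+n _) (n≤1+n _))

  keep-ahead : ∀ h c {d} → level c ≤ level h → Return h d → Return c d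
  keep-ahead _ _ c≤h (box , inj₂ (inj₂ ahead)) = box , inj₂ (inj₂ (≤-trans (s≤s c≤h) ahead))
  keep-ahead _ _ _ (box , inj₁ body) = box , inj₁ body
  keep-ahead _ _ _ (box , inj₂ (inj₁ e)) = box , inj₂ (inj₁ e)

  roof : Growing origin (Return (proj₁ buffer , ceiling)) (proj₁ buffer , ceiling) (suc (suc (7 + 7) + suc (suc bodyLength)))
  roof = grow (proj₁ buffer , ceiling) leaveBody moved-up far
              ((buffer≤right-edge , n≤1+n _) , inj₂ (inj₁ refl))
              (λ (body , _) → body-inBox body , inj₁ body)
    where
    far : ∀ {d} → Below buffer d → Far (proj₁ buffer , ceiling) d
    far {d} ((_ , y≤ , _) , _) = far-y _ d (s≤s (s≤s y≤))

  rowLeft : ∀ j {L} → j ≤ proj₁ buffer → Growing origin (Return (j , ceiling)) (j , ceiling) L →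
            Growing origin (Return (0 , ceiling)) (0 , ceiling) (j + L)
  rowLeft zero _ g = g
  rowLeft (suc j) {L} j< g =
    subst (Growing origin (Return (0 , ceiling)) (0 , ceiling)) (+-suc j L)
      (rowLeft j (≤-trans (n≤1+n _) j<)
        (grow (j , ceiling) g moved-left far
              ((≤-trans j< buffer≤right-edge , ≤-refl) , inj₂ (inj₂ ≤-refl))
              (keep-ahead (suc j , ceiling) (j , ceiling) (n≤1+n _))))
    where
    far : ∀ {d} → Return (suc j , ceiling) d → Far (j , ceiling) d
    far {d} (_ , inj₁ (_ , y≤ , _)) = far-y _ d (s≤s (s≤s y≤))
    far (_ , inj₂ (inj₁ refl)) = far-cross′ _ buffer
      (≤-trans (≤-reflexive (cong suc (sym (+-suc j (suc top))))) (+-monoˡ-≤ ceiling j<))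
    far {d} (_ , inj₂ (inj₂ ahead)) = far-level′ _ d ahead

  columnDown : ∀ j {L} → j + 8 ≤ ceiling → Growing origin (Return (0 , j + 8)) (0 , j + 8) L →
               Growing origin (Return (0 , 8)) (0 , 8) (j + L)
  columnDown zero _ g = g
  columnDown (suc j) {L} j+8< g =
    subst (Growing origin (Return (0 , 8)) (0 , 8)) (+-suc j L)
      (columnDown j (≤-trans (n≤1+n _) j+8<)
        (grow (0 , j + 8) g moved-down far ((z≤n , j+8<) , inj₂ (inj₂ ≤-refl)) (keep-ahead (0 , suc (j + 8)) (0 , j + 8) (n≤1+n _))))
    where
    far : ∀ {d} → Return (0 , suc (j + 8)) d → Far (0 , j + 8) d
    far {d} (_ , inj₁ (_ , _ , inj₁ 2≤x)) = far-x′ _ d 2≤x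
    far (_ , inj₁ (_ , _ , inj₂ refl)) = far-cross′ _ origin (s≤s (m≤n+m 8 j))
    far (_ , inj₂ (inj₁ refl)) = far-x′ _ buffer 2≤buffer
    far {d} (_ , inj₂ (inj₂ ahead)) = far-level′ _ d ahead

  routeLength : ℕ
  routeLength = (6 * p + 7) + (proj₁ buffer + suc (suc (7 + 7) + suc (suc bodyLength)))

  route : Growing origin (Return (0 , 8)) (0 , 8) routeLength
  route = columnDown (6 * p + 7) (≤-reflexive (sym (column p)))
            (subst (λ h → Growing origin (Return h) h (proj₁ buffer + suc (suc (7 + 7) + suc (suc bodyLength))))
                   (cong (0 ,_) (column p)) (rowLeft (proj₁ buffer) ≤-refl roof))
    where
    column : ∀ p → suc (suc (6 * p + 13)) ≡ (6 * p + 7) + 8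
    column = solve-∀

  module _ {m n : ℕ} (n> : right-edge < n) (m> : ceiling < m) where
    open Growing route

    inGrid : ∀ {d} → InBox d → InGrid m n d
    inGrid (x≤ , y≤) = ≤-<-trans x≤ n> , ≤-<-trans y≤ m>

    8≤ceiling : 8 ≤ ceiling
    8≤ceiling = ≤-trans (m≤m+n 8 7) (≤-trans (m≤n+m 15 (6 * p)) (≤-reflexive (column p)))
      where
      column : ∀ p → 6 * p + 15 ≡ suc (suc (6 * p + 13))
      column = solve-∀

    route-inGrid : All (InGrid m n) ((0 , 8) ∷ cells)
    route-inGrid = inGrid (z≤n , 8≤ceiling) ∷ All.map (λ r → inGrid (proj₁ r)) older

    routePath : SnakePath m n routeLength
    routePath = subst (SnakePath m n) size (chain⇒snakePath chain route-inGrid)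

    routeCycle : SnakeCycle m n (suc (suc routeLength))
    routeCycle = subst (λ k → SnakeCycle m n (suc (suc k))) size
      (chain⇒snakeCycle (0 , 7) chain moved-down (subst (Adj (0 , 7)) (sym ends) moved-left)
         (All.map closing older) (subst (1 ≤_) (sym size) 1≤routeLength)
         (inGrid (z≤n , ≤-trans (n≤1+n 7) 8≤ceiling) ∷ route-inGrid))
      where
      1≤routeLength : 1 ≤ routeLength
      1≤routeLength = ≤-trans (≤-trans (s≤s z≤n) (m≤n+m 7 (6 * p))) (m≤m+n _ _)
      closing : ∀ {d} → Return (0 , 8) d → Far (0 , 7) d ⊎ d ≡ chainEnd (0 , 8) cells
      closing {d} (_ , inj₁ (_ , _ , inj₁ 2≤x)) = inj₁ (far-x′ _ d 2≤x)
      closing (_ , inj₁ (_ , _ , inj₂ refl)) = inj₂ (sym ends)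
      closing (_ , inj₂ (inj₁ refl)) = inj₁ (far-x′ _ buffer 2≤buffer)
      closing {d} (_ , inj₂ (inj₂ ahead)) = inj₁ (far-level′ _ d ahead)

-- Lower bound

snakePath-transpose : ∀ {m n k} → SnakePath m n k → SnakePath n m k
snakePath-transpose P = record
  { vertex   = transpose ∘′ vertex
  ; inGrid   = λ i → proj₂ (inGrid i) , proj₁ (inGrid i)
  ; distinct = λ i j e → distinct i j (cong transpose e)
  ; induced  = λ i j → mk⇔ (Equivalence.to (induced i j) ∘′ adj-transpose)
                           (adj-transpose ∘′ Equivalence.from (induced i j))
  }
  where open SnakePath P

snakeCycle-transpose : ∀ {m n k} → SnakeCycle m n k → SnakeCycle n m k
snakeCycle-transpose C = record
  { long     = long
  ; vertex   = transpose ∘′ vertex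
  ; inGrid   = λ i → proj₂ (inGrid i) , proj₁ (inGrid i)
  ; distinct = λ i j e → distinct i j (cong transpose e)
  ; induced  = λ i j → mk⇔ (Equivalence.to (induced i j) ∘′ adj-transpose)
                           (adj-transpose ∘′ Equivalence.from (induced i j))
  }
  where open SnakeCycle C

LongSnakes : ℕ → ℕ → Set
LongSnakes m n = (∃[ k ] SnakePath m n k × 2 * (m * n) ≤ 3 * k + 40 * (m + n))
               × (∃[ k ] (SnakeCycle m n k ⊎ k ≡ 0) × 2 * (m * n) ≤ 3 * k + 40 * (m + n))

longSnakes-transpose : ∀ {m n} → LongSnakes n m → LongSnakes m n
longSnakes-transpose {m} {n} ((k , P , kP) , (l , C , lC)) =
  (k , snakePath-transpose P , swap-bound k kP) , (l , Sum.map₁ snakeCycle-transpose C , swap-bound l lC)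
  where
  swap-bound : ∀ k → 2 * (n * m) ≤ 3 * k + 40 * (n + m) → 2 * (m * n) ≤ 3 * k + 40 * (m + n)
  swap-bound k = subst₂ (λ a b → 2 * a ≤ 3 * k + 40 * b) (*-comm n m) (+-comm n m)

longSnakes-thin : ∀ {m n} → 1 ≤ m → 1 ≤ n → m ≤ 18 → LongSnakes m n
longSnakes-thin {m} {n} 1≤m 1≤n m≤18 =
  (0 , chain⇒snakePath (start (0 , 0)) ((1≤n , 1≤m) ∷ []) , small) , (0 , inj₂ refl , small)
  where
  small : 2 * (m * n) ≤ 40 * (m + n)
  small = begin
    2 * (m * n)  ≤⟨ *-monoʳ-≤ 2 (*-monoˡ-≤ n m≤18) ⟩
    2 * (18 * n) ≡⟨ *-assoc 2 18 n ⟨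
    36 * n       ≤⟨ *-monoˡ-≤ n (m≤m+n 36 4) ⟩
    40 * n       ≤⟨ *-monoʳ-≤ 40 (m≤n+m n m) ⟩
    40 * (m + n) ∎
    where open ≤-Reasoning

routeLength≡ : ∀ p β → Construction.routeLength p β ≡ 24 * p * p + 24 * p * β + 128 * p + 58 * β + 140
routeLength≡ = expand
  where
  expand : ∀ p β → (6 * p + 7) + ((6 * p + 6 * β + 11) + suc (suc (7 + 7) + suc (suc
                ((12 * p * p + 36 * p) + ((24 * p + 44) + (β * (24 * p + 52) +
                  ((24 * suc p * 1 + 12 * suc p * suc p + 8 * suc p) + 16)))))))
              ≡ 24 * p * p + 24 * p * β + 128 * p + 58 * β + 140
  expand = solve-∀

longSnakes-constructed : ∀ p β {r r′} → r ≤ 5 → r′ ≤ 5 → LongSnakes (6 * p + 19 + r) (6 * p + 6 * β + 19 + r′)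
longSnakes-constructed p β {r} {r′} r≤5 r′≤5 =
  (R , routePath n> m> , long) ,
  (suc (suc R) , inj₁ (routeCycle n> m>) , ≤-trans long (+-monoˡ-≤ (40 * (m + n)) (*-monoʳ-≤ 3 (≤-trans (n≤1+n R) (n≤1+n _)))))
  where
  open Construction p β
  m n R m₀ n₀ : ℕ
  m  = 6 * p + 19 + r
  n  = 6 * p + 6 * β + 19 + r′
  R  = routeLength
  m₀ = 6 * p + 19
  n₀ = 6 * p + 6 * β + 19

  n> : right-edge < n
  n> = ≤-by r′ (columns p β r′)
    where
    columns : ∀ p β r′ → suc (6 * p + 6 * β + 18) + r′ ≡ 6 * p + 6 * β + 19 + r′
    columns = solve-∀

  m> : ceiling < m
  m> = ≤-by (3 + r) (rows p r)
    where
    rows : ∀ p r → suc (suc (suc (6 * p + 13))) + (3 + r) ≡ 6 * p + 19 + r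
    rows = solve-∀

  slack : ∀ p β → 3 * (24 * p * p + 24 * p * β + 128 * p + 58 * β + 140) + 40 * ((6 * p + 19) + (6 * p + 6 * β + 19))
                ≡ 2 * (((6 * p + 19) + 5) * ((6 * p + 6 * β + 19) + 5)) + (288 * p + 126 * β + 788)
  slack = solve-∀

  long : 2 * (m * n) ≤ 3 * R + 40 * (m + n)
  long = begin
    2 * (m * n)                          ≤⟨ *-monoʳ-≤ 2 (*-mono-≤ (+-monoʳ-≤ m₀ r≤5) (+-monoʳ-≤ n₀ r′≤5)) ⟩
    2 * ((m₀ + 5) * (n₀ + 5))            ≤⟨ m≤m+n _ (288 * p + 126 * β + 788) ⟩
    2 * ((m₀ + 5) * (n₀ + 5)) + (288 * p + 126 * β + 788)
                                         ≡⟨ slack p β ⟨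
    3 * (24 * p * p + 24 * p * β + 128 * p + 58 * β + 140) + 40 * (m₀ + n₀)
                                         ≡⟨ cong (λ z → 3 * z + 40 * (m₀ + n₀)) (routeLength≡ p β) ⟨
    3 * R + 40 * (m₀ + n₀)               ≤⟨ +-monoʳ-≤ (3 * R) (*-monoʳ-≤ 40 (+-mono-≤ (m≤m+n m₀ r) (m≤m+n n₀ r′))) ⟩
    3 * R + 40 * (m + n)                 ∎
    where open ≤-Reasoning

divMod6 : ∀ a → ∃[ q ] ∃[ r ] r ≤ 5 × a ≡ 6 * q + r
divMod6 a = a / 6 , a % 6 , s≤s⁻¹ (m%n<n a 6) , trans (m≡m%n+[m/n]*n a 6) (reorder (a % 6) (a / 6))
  where
  reorder : ∀ r q → r + q * 6 ≡ 6 * q + r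
  reorder = solve-∀

longSnakes-ordered : ∀ {m n} → m ≤ n → 1 ≤ m → 1 ≤ n → LongSnakes m n
longSnakes-ordered {m} {n} m≤n 1≤m 1≤n with m <? 19
... | yes m<19 = longSnakes-thin 1≤m 1≤n (s≤s⁻¹ m<19)
... | no m≮19 with divMod6 (m ∸ 19)
... | p , r , r≤5 , m∸19≡ with divMod6 (r + (n ∸ m))
... | β , r′ , r′≤5 , excess≡ = subst₂ LongSnakes (sym m≡) (sym n≡) (longSnakes-constructed p β r≤5 r′≤5)
  where
  m≡ : m ≡ 6 * p + 19 + r
  m≡ = begin
    m                  ≡⟨ m+[n∸m]≡n (≮⇒≥ m≮19) ⟨
    19 + (m ∸ 19)      ≡⟨ cong (19 +_) m∸19≡ ⟩
    19 + (6 * p + r)   ≡⟨ reorder p r ⟩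
    6 * p + 19 + r     ∎
    where
    open ≡-Reasoning
    reorder : ∀ p r → 19 + (6 * p + r) ≡ 6 * p + 19 + r
    reorder = solve-∀

  n≡ : n ≡ 6 * p + 6 * β + 19 + r′
  n≡ = begin
    n                             ≡⟨ m+[n∸m]≡n m≤n ⟨
    m + (n ∸ m)                   ≡⟨ cong (_+ (n ∸ m)) m≡ ⟩
    6 * p + 19 + r + (n ∸ m)      ≡⟨ +-assoc (6 * p + 19) r (n ∸ m) ⟩
    6 * p + 19 + (r + (n ∸ m))    ≡⟨ cong (6 * p + 19 +_) excess≡ ⟩
    6 * p + 19 + (6 * β + r′)     ≡⟨ reorder p β r′ ⟩
    6 * p + 6 * β + 19 + r′       ∎
    where
    open ≡-Reasoning
    reorder : ∀ p β r′ → 6 * p + 19 + (6 * β + r′) ≡ 6 * p + 6 * β + 19 + r′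
    reorder = solve-∀

longSnakes : ∀ {m n} → 1 ≤ m → 1 ≤ n → LongSnakes m n
longSnakes {m} {n} 1≤m 1≤n with ≤-total m n
... | inj₁ m≤n = longSnakes-ordered m≤n 1≤m 1≤n
... | inj₂ n≤m = longSnakes-transpose (longSnakes-ordered n≤m 1≤n 1≤m)

upper-weaken : ∀ b s {a} → a ≤ b + 6 * s → a ≤ b + 40 * s
upper-weaken b s a≤ = ≤-trans a≤ (+-monoʳ-≤ b (*-monoˡ-≤ s (m≤m+n 6 34)))

proposition3 : Σ ℕ λ C → (m n : ℕ) → 1 ≤ m → 1 ≤ n →
    ((∀ k → SnakePath m n k → 3 * k ≤ 2 * (m * n) + C * (m + n))
     × (Σ ℕ λ k → SnakePath m n k × (2 * (m * n) ≤ 3 * k + C * (m + n))))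
    × ((∀ k → SnakeCycle m n k → 3 * k ≤ 2 * (m * n) + C * (m + n))
     × (Σ ℕ λ k → (SnakeCycle m n k ⊎ k ≡ 0) × (2 * (m * n) ≤ 3 * k + C * (m + n))))
proposition3 = 40 , λ m n 1≤m 1≤n →
  let (longPath , longCycle) = longSnakes 1≤m 1≤n in
  ((λ _ P → upper-weaken (2 * (m * n)) (m + n) (snakePath-upper 1≤n P)) , longPath) ,
  ((λ _ C → upper-weaken (2 * (m * n)) (m + n) (snakeCycle-upper 1≤n C)) , longCycle)
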